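{- There exists a finite simple graph $G$ such that no interval supergraph $G'$ of $G$ satisfies both $\mathrm{iwid}(G')=\mathrm{iwid}(G)$ and $\mathrm{icost}(G')=\mathrm{icost}(G)$.
   Context: An interval graph is one whose vertices $v$ can be assigned open real intervals $I_v=(l_v,r_v)$ with $\{u,v\}$ an edge iff $I_u\cap I_v\neq\emptyset$; the collection $\mathcal{I}$ is an interval representation. With $n$ vertices, $\mathcal{I}$ is canonical if all endpoints are integers and $\{l_v\}=\{1,\ldots,n\}$. For real $x$, $m_x(\mathcal{I})$ is the number of intervals containing $x$; $\mathrm{wid}(\mathcal{I})=\max_x m_x(\mathcal{I})$; and $\mathrm{icost}(\mathcal{I})=\sum_{v} m_{l_v}(\mathcal{I})$ (the number of intervals containing the left endpoint of $I_v$, summed over all vertices). For an arbitrary graph $G$, let $\mathcal{R}(G)$ be the set of all canonical interval representations of interval graphs on vertex set $V(G)$ that are supergraphs of $G$ (if $G$ is itself an interval graph this is just all canonical interval representations of interval supergraphs on the same vertex set, including those of $G$). Then $\mathrm{iwid}(G)=\min\{\mathrm{wid}(\mathcal{I}):\mathcal{I}\in\mathcal{R}(G)\}$ and $\mathrm{icost}(G)=\min\{\mathrm{icost}(\mathcal{I}):\mathcal{I}\in\mathcal{R}(G)\}$. (Equivalently, $\mathrm{iwid}(G)=\mathrm{pw}(G)+1$ and $\mathrm{icost}(G)$ equals the profile of $G$, the minimum number of edges of an interval supergraph of $G$.)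
   Formalization: The interval endpoints and the points x at which $m_x$ and interval intersections are evaluated range over ℚ rather than the reals. -}

module Defs where

open import Data.Nat using (ℕ; zero; suc; _+_; _≤_; _<_)
open import Data.Fin using (Fin; toℕ)
open import Data.Bool using (Bool; true; false)
open import Data.Nat.ListAction using (sum)
open import Data.List using (allFin) renaming (map to lmap)
open import Data.Integer using (+_)
open import Data.Rational using (ℚ; _/_) renaming (_<_ to _<ℚ_)
open import Data.Rational.Properties using (_<?_)
open import Data.Product using (Σ; ∃; _×_; _,_)
open import Relation.Binary.PropositionalEquality using (_≡_; _≢_)
open import Relation.Nullary using (does; Dec)
open import Relation.Nullary.Decidable using (_×-dec_)
open import Data.Bool using (if_then_else_)
open import Function.Bundles using (_⇔_)

record Graph (n : ℕ) : Set where
  field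
    adj    : Fin n → Fin n → Bool
    sym    : ∀ u v → adj u v ≡ adj v u
    irrefl : ∀ v → adj v v ≡ false
open Graph public

Edge : ∀ {n} → Graph n → Fin n → Fin n → Set
Edge G u v = adj G u v ≡ true

_⊆G_ : ∀ {n} → Graph n → Graph n → Set
G ⊆G G' = ∀ u v → Edge G u v → Edge G' u v

-- Open intervals (left v , right v) with endpoints in ℚ (stand-in for ℝ).
Contains : ∀ {n} → (Fin n → ℚ) → (Fin n → ℚ) → Fin n → ℚ → Set
Contains lf rf v x = (lf v <ℚ x) × (x <ℚ rf v)

Meets : ∀ {n} → (Fin n → ℚ) → (Fin n → ℚ) → Fin n → Fin n → Set
Meets lf rf u v = ∃ λ x → Contains lf rf u x × Contains lf rf v x

record IntervalFamily (n : ℕ) : Set where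
  field
    left  : Fin n → ℚ
    right : Fin n → ℚ
    nonempty : ∀ v → left v <ℚ right v
open IntervalFamily public

Represents : ∀ {n} → IntervalFamily n → Graph n → Set
Represents I G = ∀ u v → u ≢ v → (Edge G u v ⇔ Meets (left I) (right I) u v)

IsIntervalGraph : ∀ {n} → Graph n → Set
IsIntervalGraph {n} G = Σ (IntervalFamily n) λ I → Represents I G

ℕ→ℚ : ℕ → ℚ
ℕ→ℚ k = (+ k) / 1

record Canonical (n : ℕ) : Set where
  field
    l r : Fin n → ℕ
    l<r : ∀ v → l v < r v
    l-range : ∀ v → (1 ≤ l v) × (l v ≤ n)
    l-onto  : ∀ k → 1 ≤ k → k ≤ n → ∃ λ v → l v ≡ k
open Canonical public

lQ rQ : ∀ {n} → Canonical n → Fin n → ℚ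
lQ C v = ℕ→ℚ (l C v)
rQ C v = ℕ→ℚ (r C v)

count : ∀ {n} {P : Fin n → Set} → ((v : Fin n) → Dec (P v)) → ℕ
count {n} P? = sum (lmap (λ v → if does (P? v) then 1 else 0) (allFin n))

contains? : ∀ {n} (C : Canonical n) (x : ℚ) (v : Fin n) → Dec (Contains (lQ C) (rQ C) v x)
contains? C x v = (lQ C v <? x) ×-dec (x <? rQ C v)

mult : ∀ {n} → Canonical n → ℚ → ℕ
mult C x = count (contains? C x)

IsWid : ∀ {n} → Canonical n → ℕ → Set
IsWid C w = (∀ x → mult C x ≤ w) × ∃ λ x → mult C x ≡ w

icostRep : ∀ {n} → Canonical n → ℕ
icostRep {n} C = sum (lmap (λ v → mult C (lQ C v)) (allFin n))

InR : ∀ {n} → Graph n → Canonical n → Set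
InR G C = ∀ u v → Edge G u v → Meets (lQ C) (rQ C) u v

IsIwid : ∀ {n} → Graph n → ℕ → Set
IsIwid {n} G w =
  (Σ (Canonical n) λ C → InR G C × IsWid C w) ×
  (∀ (C : Canonical n) → InR G C → ∀ w' → IsWid C w' → w ≤ w')

IsIcost : ∀ {n} → Graph n → ℕ → Set
IsIcost {n} G c =
  (Σ (Canonical n) λ C → InR G C × icostRep C ≡ c) ×
  (∀ (C : Canonical n) → InR G C → c ≤ icostRep C)

-- G is the graph on 0, …, 7 with edges 02 03 05 12 23 24 26 34 35 37 47. Explicit canonical
-- representations show iwid G ≤ 3 and icost G ≤ 12. In a canonical representation of an
-- interval graph every edge uv with l u < l v is counted in icost at the left endpoint of v,
-- so an interval supergraph G′ with icost G′ = icost G has at most 12 edges, i.e. at most one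
-- edge more than G; and by the Helly property iwid G′ = iwid G ≤ 3 rules out a K₄ in G′.
-- Being an interval graph, G′ has no chordless 4- or 5-cycle and no asteroidal triple. But
-- 1, 5, 7 is an asteroidal triple of G that survives unless one of eight edges is added, and
-- each of these eight edges creates a K₄, a chordless cycle or another asteroidal triple.

module Submission where

open import Defs hiding (sym)
open import Data.Nat using (ℕ; zero; suc; _+_; _≤_; _<_; z≤n; s≤s; _≤?_; _<?_; _<ᵇ_)
import Data.Nat as ℕ
import Data.Nat.Properties as ℕ
open import Data.Nat.ListAction using (sum)
open import Data.Nat.Coprimality using (1-coprimeTo) renaming (sym to coprime-sym)
import Data.Integer as ℤ
open import Data.Integer.Properties using (*-identityʳ)
open import Data.Rational using (mkℚ; *<*; *≤*; _/_) renaming (_<_ to _<ℚ_; _≤_ to _≤ℚ_)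
open import Data.Rational.Properties using (normalize-coprime)
open import Data.Fin using (Fin; zero; suc; toℕ; fromℕ<; punchOut; #_)
import Data.Fin as Fin
open import Data.Fin.Properties
  using (punchOut-injective; suc-injective; toℕ-injective; toℕ<n; toℕ-fromℕ<; any?; all?; pigeonhole; _≟_)
open import Data.Bool using (Bool; true; false; T; _∨_; if_then_else_)
import Data.Bool as Bool
open import Data.Bool.Properties using (∨-comm; T-≡)
open import Data.Vec using ([]; _∷_; lookup)
open import Data.List using (List; []; _∷_; allFin; tabulate) renaming (map to lmap)
open import Data.List.Properties using (map-tabulate)
open import Data.List.Relation.Unary.Any as Any using (Any; here; there)
open import Data.List.Relation.Unary.All as All using (All; []; _∷_)
open import Data.List.Relation.Unary.All.Properties using (All¬⇒¬Any)
open import Data.List.Relation.Unary.AllPairs using (AllPairs; []; _∷_)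
import Data.List.Relation.Unary.AllPairs as AllPairs
open import Data.List.Membership.Propositional using (_∈_)
open import Data.Product using (Σ; ∃; ∃₂; ∃-syntax; _×_; _,_; proj₁; proj₂)
open import Data.Product.Properties using (≡-dec)
open import Data.Sum as Sum using (_⊎_; inj₁; inj₂)
open import Data.Empty using (⊥; ⊥-elim)
open import Function using (Injective; _∘_; id)
open import Function.Bundles using (Equivalence)
open import Relation.Nullary using (¬_; Dec; yes; no; does)
open import Relation.Nullary.Decidable
  using (True; False; toWitness; toWitnessFalse; from-yes; _×-dec_; _⊎-dec_; _→-dec_)
open import Relation.Unary using (Decidable)
open import Relation.Binary using (tri<; tri≈; tri>)
open import Relation.Binary.Bundles using (DecTotalOrder)
open import Relation.Binary.PropositionalEquality using (_≡_; _≢_; refl; sym; trans; cong; cong₂; subst; subst₂)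
open import Algebra.Properties.CommutativeMonoid.Sum ℕ.+-0-commutativeMonoid
  using (sum-syntax; ∑-comm; ∑-distrib-+; sum-cong-≗) renaming (sum to ∑)

-- Counting over Fin n

𝟙 : ∀ {a} {A : Set a} → Dec A → ℕ
𝟙 A? = if does A? then 1 else 0

sum-tabulate : ∀ {n} (f : Fin n → ℕ) → sum (tabulate f) ≡ ∑[ i < n ] f i
sum-tabulate {zero}  f = refl
sum-tabulate {suc n} f = cong (f zero +_) (sum-tabulate (f ∘ suc))

sum-allFin : ∀ {n} (f : Fin n → ℕ) → sum (lmap f (allFin n)) ≡ ∑[ i < n ] f i
sum-allFin f = trans (cong sum (map-tabulate id f)) (sum-tabulate f)

count-∑ : ∀ {n} {P : Fin n → Set} (P? : Decidable P) → count P? ≡ ∑[ v < n ] 𝟙 (P? v)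
count-∑ P? = sum-allFin (𝟙 ∘ P?)

∑-mono-≤ : ∀ {n} {f g : Fin n → ℕ} → (∀ i → f i ≤ g i) → ∑[ i < n ] f i ≤ ∑[ i < n ] g i
∑-mono-≤ {zero}  f≤g = z≤n
∑-mono-≤ {suc n} f≤g = ℕ.+-mono-≤ (f≤g zero) (∑-mono-≤ (f≤g ∘ suc))

𝟙-mono : ∀ {a b} {A : Set a} {B : Set b} (A? : Dec A) (B? : Dec B) → (A → B) → 𝟙 A? ≤ 𝟙 B?
𝟙-mono (no _)  _       _   = z≤n
𝟙-mono (yes a) (yes _) _   = ℕ.≤-refl
𝟙-mono (yes a) (no ¬b) A→B with () ← ¬b (A→B a)

𝟙-yes : ∀ {a} {A : Set a} (A? : Dec A) → A → 1 ≤ 𝟙 A?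
𝟙-yes (yes _) _ = ℕ.≤-refl
𝟙-yes (no ¬a) a with () ← ¬a a

count-mono : ∀ {n} {P Q : Fin n → Set} (P? : Decidable P) (Q? : Decidable Q) →
             (∀ v → P v → Q v) → count P? ≤ count Q?
count-mono P? Q? P⊆Q rewrite count-∑ P? | count-∑ Q? = ∑-mono-≤ λ v → 𝟙-mono (P? v) (Q? v) (P⊆Q v)

∑-injection : ∀ {n k} {P : Fin n → Set} (P? : Decidable P) (f : ∀ v → P v → Fin k) →
              (∀ {u v} pu pv → f u pu ≡ f v pv → u ≡ v) → ∑[ v < n ] 𝟙 (P? v) ≤ k
∑-injection {zero} P? f f-inj = z≤n
∑-injection {suc n} P? f f-inj with P? zero
... | no _ = ∑-injection (P? ∘ suc) (f ∘ suc) λ pu pv → suc-injective ∘ f-inj pu pv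
∑-injection {suc n} {suc k} {P = P} P? f f-inj | yes p₀ = s≤s (∑-injection (P? ∘ suc) f′ f′-inj)
  where
  f₀≢f : ∀ {v} pv → f zero p₀ ≢ f (suc v) pv
  f₀≢f pv eq with () ← f-inj p₀ pv eq
  f′ : ∀ v → P (suc v) → Fin k
  f′ v pv = punchOut (f₀≢f pv)
  f′-inj : ∀ {u v} pu pv → f′ u pu ≡ f′ v pv → u ≡ v
  f′-inj pu pv = suc-injective ∘ f-inj pu pv ∘ punchOut-injective (f₀≢f pu) (f₀≢f pv)
∑-injection {suc n} {zero} P? f f-inj | yes p₀ with () ← f zero p₀

count-injection : ∀ {n k} {P : Fin n → Set} (P? : Decidable P) (f : ∀ v → P v → Fin k) →
                  (∀ {u v} pu pv → f u pu ≡ f v pv → u ≡ v) → count P? ≤ k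
count-injection P? f f-inj rewrite count-∑ P? = ∑-injection P? f f-inj

module _ {n : ℕ} where

  open import Data.List.Membership.DecPropositional (_≟_ {n}) using (_∈?_)

  distinct : List (Fin n) → ℕ
  distinct vs = count (_∈? vs)

  distinct-≤-count : ∀ {P : Fin n → Set} (P? : Decidable P) {vs} → All P vs → distinct vs ≤ count P?
  distinct-≤-count P? {vs} all = count-mono (_∈? vs) P? (λ _ → All.lookup all)


-- Families of open intervals

module OpenIntervals {n : ℕ} (I : IntervalFamily n) where

  open import Data.Rational using (ℚ)
  open import Data.Rational.Properties
    using (≤-refl; ≤-trans; <⇒≤; ≮⇒≥; ≰⇒>; <-irrefl; <-trans; <-≤-trans; ≤-<-trans; <-dense; ≤-decTotalOrder)
    renaming (_<?_ to _<ℚ?_; _≤?_ to _≤ℚ?_)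
  open import Data.List.Extrema (DecTotalOrder.totalOrder ≤-decTotalOrder)
    using (argmax; argmax-all; argmin-all; f[⊥]≤f[argmax]; f[xs]≤f[argmax]; f[argmin]≤f[⊤]; f[argmin]≤f[xs])

  private
    lf rf : Fin n → ℚ
    lf = left I
    rf = right I

  infix 4 _∋_ _meets_ _≺_

  _∋_ : Fin n → ℚ → Set
  v ∋ x = Contains lf rf v x

  _meets_ : Fin n → Fin n → Set
  _meets_ = Meets lf rf

  _≺_ : Fin n → Fin n → Set
  u ≺ v = rf u ≤ℚ lf v

  meets-sym : ∀ {u v} → u meets v → v meets u
  meets-sym (x , u∋x , v∋x) = x , v∋x , u∋x

  meets⇒left<right : ∀ {u v} → u meets v → lf u <ℚ rf v
  meets⇒left<right (_ , (lu<x , _) , (_ , x<rv)) = <-trans lu<x x<rv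

  subinterval⇒meets : ∀ {u v a b} → lf u ≤ℚ a → lf v ≤ℚ a → b ≤ℚ rf u → b ≤ℚ rf v → a <ℚ b → u meets v
  subinterval⇒meets lu≤a lv≤a b≤ru b≤rv a<b with x , a<x , x<b ← <-dense a<b =
    x , (≤-<-trans lu≤a a<x , <-≤-trans x<b b≤ru) , (≤-<-trans lv≤a a<x , <-≤-trans x<b b≤rv)

  overlap⇒meets : ∀ {u v} → lf u <ℚ rf v → lf v <ℚ rf u → u meets v
  overlap⇒meets {u} {v} lu<rv lv<ru with lf u ≤ℚ? lf v | rf u ≤ℚ? rf v
  ... | yes lu≤lv | yes ru≤rv = subinterval⇒meets lu≤lv ≤-refl ≤-refl ru≤rv lv<ru
  ... | yes lu≤lv | no  ru≰rv = subinterval⇒meets lu≤lv ≤-refl (<⇒≤ (≰⇒> ru≰rv)) ≤-refl (nonempty I v)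
  ... | no  lu≰lv | yes ru≤rv = subinterval⇒meets ≤-refl (<⇒≤ (≰⇒> lu≰lv)) ≤-refl ru≤rv (nonempty I u)
  ... | no  lu≰lv | no  ru≰rv = subinterval⇒meets ≤-refl (<⇒≤ (≰⇒> lu≰lv)) (<⇒≤ (≰⇒> ru≰rv)) ≤-refl lu<rv

  disjoint⇒≺ : ∀ {u v} → ¬ u meets v → u ≺ v ⊎ v ≺ u
  disjoint⇒≺ {u} {v} u≁v with rf u ≤ℚ? lf v | rf v ≤ℚ? lf u
  ... | yes u≺v | _       = inj₁ u≺v
  ... | no  _   | yes v≺u = inj₂ v≺u
  ... | no u⊀v  | no v⊀u with () ← u≁v (overlap⇒meets (≰⇒> v⊀u) (≰⇒> u⊀v))

  ≺⇒¬meets : ∀ {u v} → u ≺ v → ¬ u meets v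
  ≺⇒¬meets u≺v u⌢v = <-irrefl refl (<-≤-trans (meets⇒left<right (meets-sym u⌢v)) u≺v)

  locate : ∀ v x → v ∋ x ⊎ rf v ≤ℚ x ⊎ x ≤ℚ lf v
  locate v x with lf v <ℚ? x | x <ℚ? rf v
  ... | yes lv<x | yes x<rv = inj₁ (lv<x , x<rv)
  ... | yes _    | no  x≮rv = inj₂ (inj₁ (≮⇒≥ x≮rv))
  ... | no  lv≮x | _        = inj₂ (inj₂ (≮⇒≥ lv≮x))

  Separates : ℚ → Fin n → Fin n → Set
  Separates x u v = (rf u ≤ℚ x × x ≤ℚ lf v) ⊎ (rf v ≤ℚ x × x ≤ℚ lf u)

  separates⇒¬meets : ∀ {x u v} → Separates x u v → ¬ u meets v
  separates⇒¬meets (inj₁ (ru≤x , x≤lv)) = ≺⇒¬meets (≤-trans ru≤x x≤lv)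
  separates⇒¬meets (inj₂ (rv≤x , x≤lu)) = ≺⇒¬meets (≤-trans rv≤x x≤lu) ∘ meets-sym

  disjoint⇒separated : ∀ {u v} → ¬ u meets v → ∃[ x ] Separates x u v
  disjoint⇒separated {u} {v} u≁v with disjoint⇒≺ u≁v
  ... | inj₁ u≺v = rf u , inj₁ (≤-refl , u≺v)
  ... | inj₂ v≺u = rf v , inj₂ (≤-refl , v≺u)

  infixr 5 _∷_

  data Walk : Fin n → Fin n → Set where
    [_] : ∀ {s t} → s meets t → Walk s t
    _∷_ : ∀ {s v t} → s meets v → Walk v t → Walk s t

  inner : ∀ {s t} → Walk s t → List (Fin n)
  inner [ _ ]               = []
  inner (_∷_ {v = v} _ P) = v ∷ inner P

  -- Consecutive intervals of a walk meet, so the walk cannot jump over the point x.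
  walk-crosses : ∀ {s t x} (P : Walk s t) → Separates x s t → Any (_∋ x) (inner P)
  walk-crosses [ s⌢t ] sep with () ← separates⇒¬meets sep s⌢t
  walk-crosses {x = x} (_∷_ {v = v} s⌢v P) sep with locate v x | sep
  ... | inj₁ v∋x        | _               = here v∋x
  ... | inj₂ (inj₁ rv≤x) | inj₁ (_ , x≤lt) = there (walk-crosses P (inj₁ (rv≤x , x≤lt)))
  ... | inj₂ (inj₂ x≤lv) | inj₂ (rt≤x , _) = there (walk-crosses P (inj₂ (rt≤x , x≤lv)))
  ... | inj₂ (inj₂ x≤lv) | inj₁ (rs≤x , _) with () ← separates⇒¬meets (inj₁ (rs≤x , x≤lv)) s⌢v
  ... | inj₂ (inj₁ rv≤x) | inj₂ (_ , x≤ls) with () ← separates⇒¬meets (inj₂ (rv≤x , x≤ls)) s⌢v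

  Anticomplete : List (Fin n) → List (Fin n) → Set
  Anticomplete us vs = All (λ u → All (λ v → ¬ u meets v) vs) us

  walks-around-gap-meet : ∀ {a c} → ¬ a meets c → (P Q : Walk a c) → ¬ Anticomplete (inner P) (inner Q)
  walks-around-gap-meet a≁c P Q anti
    with x , sep ← disjoint⇒separated a≁c
    with u≁Q , u∋x ← All.lookupAny anti (walk-crosses P sep)
    with u≁v , v∋x ← All.lookupAny u≁Q (walk-crosses Q sep)
    = u≁v (x , u∋x , v∋x)

  Between : Fin n → Fin n → Fin n → Set
  Between s m t = ∃[ x ] m ∋ x × Separates x s t

  between : ∀ {s m t} → s ≺ m → m ≺ t → Between s m t
  between {m = m} s≺m m≺t with x , lm<x , x<rm ← <-dense (nonempty I m) =
    x , (lm<x , x<rm) , inj₁ (≤-trans s≺m (<⇒≤ lm<x) , ≤-trans (<⇒≤ x<rm) m≺t)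

  between-sym : ∀ {s m t} → Between s m t → Between t m s
  between-sym (x , m∋x , sep) = x , m∋x , Sum.swap sep

  walk-passes : ∀ {s m t} → Between s m t → (P : Walk s t) → Any (_meets m) (inner P)
  walk-passes (x , m∋x , sep) P = Any.map (λ v∋x → x , v∋x , m∋x) (walk-crosses P sep)

  one-between-others : ∀ {a b c} → ¬ a meets b → ¬ b meets c → ¬ c meets a →
                       Between a c b ⊎ Between b a c ⊎ Between c b a
  one-between-others a≁b b≁c c≁a with disjoint⇒≺ a≁b | disjoint⇒≺ b≁c | disjoint⇒≺ c≁a
  ... | inj₁ a≺b | inj₁ b≺c | _        = inj₂ (inj₂ (between-sym (between a≺b b≺c)))
  ... | inj₂ b≺a | inj₂ c≺b | _        = inj₂ (inj₂ (between c≺b b≺a))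
  ... | inj₁ a≺b | inj₂ c≺b | inj₁ c≺a = inj₂ (inj₁ (between-sym (between c≺a a≺b)))
  ... | inj₁ a≺b | inj₂ c≺b | inj₂ a≺c = inj₁ (between a≺c c≺b)
  ... | inj₂ b≺a | inj₁ b≺c | inj₁ c≺a = inj₁ (between-sym (between b≺c c≺a))
  ... | inj₂ b≺a | inj₁ b≺c | inj₂ a≺c = inj₂ (inj₁ (between b≺a a≺c))

  no-asteroidal-triple : ∀ {a b c} → ¬ a meets b → ¬ b meets c → ¬ c meets a →
                         (P : Walk a b) (Q : Walk b c) (R : Walk c a) →
                         All (λ v → ¬ v meets c) (inner P) → All (λ v → ¬ v meets a) (inner Q) →
                         All (λ v → ¬ v meets b) (inner R) → ⊥
  no-asteroidal-triple a≁b b≁c c≁a P Q R P≁c Q≁a R≁b with one-between-others a≁b b≁c c≁a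
  ... | inj₁ acb        = All¬⇒¬Any P≁c (walk-passes acb P)
  ... | inj₂ (inj₁ bac) = All¬⇒¬Any Q≁a (walk-passes bac Q)
  ... | inj₂ (inj₂ cba) = All¬⇒¬Any R≁b (walk-passes cba R)

  pairwise-overlapping : ∀ {vs} → AllPairs _meets_ vs → All (λ u → All (λ v → lf u <ℚ rf v) vs) vs
  pairwise-overlapping [] = []
  pairwise-overlapping (u⌢vs ∷ pairs) =
    (nonempty I _ ∷ All.map meets⇒left<right u⌢vs)
    ∷ All.zipWith (λ (u⌢v , row) → meets⇒left<right (meets-sym u⌢v) ∷ row) (u⌢vs , pairwise-overlapping pairs)

  -- The interval with the last left endpoint meets the one with the first right endpoint,
  -- and every point strictly between these two endpoints lies in all the intervals.
  helly : ∀ {w ws} → AllPairs _meets_ (w ∷ ws) → ∃[ x ] All (_∋ x) (w ∷ ws)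
  helly {w} {ws} pairs
    with o ∷ os ← pairwise-overlapping pairs
    with q ∷ qs ← argmax-all lf {P = λ u → All (λ v → lf u <ℚ rf v) (w ∷ ws)} o os
    with x , ℓ<x , x<ρ ← <-dense (argmin-all rf {P = λ v → lf (argmax lf w ws) <ℚ rf v} q qs)
    = x , All.zipWith (λ (lv≤ℓ , ρ≤rv) → ≤-<-trans lv≤ℓ ℓ<x , <-≤-trans x<ρ ρ≤rv)
                      ( f[⊥]≤f[argmax] {f = lf} w ws ∷ f[xs]≤f[argmax] w ws
                      , f[argmin]≤f[⊤] {f = rf} w ws ∷ f[argmin]≤f[xs] w ws )

-- Canonical representations

ℕ→ℚ≡mkℚ : ∀ a → ℕ→ℚ a ≡ mkℚ (ℤ.+ a) 0 (coprime-sym (1-coprimeTo a))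
ℕ→ℚ≡mkℚ a = normalize-coprime (coprime-sym (1-coprimeTo a))

ℕ→ℚ-mono-< : ∀ {a b} → a < b → ℕ→ℚ a <ℚ ℕ→ℚ b
ℕ→ℚ-mono-< {a} {b} a<b rewrite ℕ→ℚ≡mkℚ a | ℕ→ℚ≡mkℚ b =
  *<* (subst₂ ℤ._<_ (sym (*-identityʳ (ℤ.+ a))) (sym (*-identityʳ (ℤ.+ b))) (ℤ.+<+ a<b))

ℕ→ℚ-mono-≤ : ∀ {a b} → a ≤ b → ℕ→ℚ a ≤ℚ ℕ→ℚ b
ℕ→ℚ-mono-≤ {a} {b} a≤b rewrite ℕ→ℚ≡mkℚ a | ℕ→ℚ≡mkℚ b =
  *≤* (subst₂ ℤ._≤_ (sym (*-identityʳ (ℤ.+ a))) (sym (*-identityʳ (ℤ.+ b))) (ℤ.+≤+ a≤b))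

injective⇒surjective : ∀ {n} {f : Fin n → Fin n} → Injective _≡_ _≡_ f → ∀ y → ∃[ x ] f x ≡ y
injective⇒surjective {n} {f} f-inj y with any? (λ x → f x ≟ y)
... | yes hit = hit
... | no miss = ⊥-elim (no-collision (pigeonhole (ℕ.n<1+n n) y∷f))
  where
  y∷f : Fin (suc n) → Fin n
  y∷f zero    = y
  y∷f (suc x) = f x
  no-collision : ¬ ∃₂ λ i j → i Fin.< j × y∷f i ≡ y∷f j
  no-collision (zero  , suc j , _         , eq) = miss (j , sym eq)
  no-collision (suc i , suc j , s≤s i<j , eq) with refl ← f-inj eq = ℕ.<-irrefl refl i<j

family : ∀ {n} → Canonical n → IntervalFamily n
family C = record { left = lQ C ; right = rQ C ; nonempty = λ v → ℕ→ℚ-mono-< (l<r C v) }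

Adjacency : ℕ → Set
Adjacency n = Fin n → Fin n → Bool

arcs : ∀ {n} → Adjacency n → ℕ
arcs {n} A = ∑[ u < n ] ∑[ v < n ] 𝟙 (A u v Bool.≟ true)

arcs-mono : ∀ {n} {A B : Adjacency n} → (∀ u v → A u v ≡ true → B u v ≡ true) → arcs A ≤ arcs B
arcs-mono {A = A} {B} A⊆B = ∑-mono-≤ λ u → ∑-mono-≤ λ v → 𝟙-mono (A u v Bool.≟ true) (B u v Bool.≟ true) (A⊆B u v)

module _ {n} (C : Canonical n) where

  private
    pick : Fin n → Fin n
    pick k = proj₁ (l-onto C (suc (toℕ k)) (s≤s z≤n) (toℕ<n k))

    l∘pick : ∀ k → l C (pick k) ≡ suc (toℕ k)
    l∘pick k = proj₂ (l-onto C (suc (toℕ k)) (s≤s z≤n) (toℕ<n k))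

    pick-injective : Injective _≡_ _≡_ pick
    pick-injective {i} {j} eq =
      toℕ-injective (ℕ.suc-injective (trans (sym (l∘pick i)) (trans (cong (l C) eq) (l∘pick j))))

  l-injective : Injective _≡_ _≡_ (l C)
  l-injective {u} {v} lu≡lv
    with i , refl ← injective⇒surjective pick-injective u
       | j , refl ← injective⇒surjective pick-injective v
    = cong pick (toℕ-injective (ℕ.suc-injective (trans (sym (l∘pick i)) (trans lu≡lv (l∘pick j)))))

  open OpenIntervals (family C)

  overlap⇒meetsℕ : ∀ {u v} → l C u < r C v → l C v < r C u → u meets v
  overlap⇒meetsℕ lu<rv lv<ru = overlap⇒meets (ℕ→ℚ-mono-< lu<rv) (ℕ→ℚ-mono-< lv<ru)

  ≤⇒¬meets : ∀ {u v} → r C u ≤ l C v → ¬ u meets v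
  ≤⇒¬meets ru≤lv = ≺⇒¬meets (ℕ→ℚ-mono-≤ ru≤lv)

  DisjointWithin : ∀ {k} → (Fin n → Fin k) → Set
  DisjointWithin colour = ∀ u v → colour u ≡ colour v → u ≡ v ⊎ r C u ≤ l C v ⊎ r C v ≤ l C u

  disjoint-within? : ∀ {k} (colour : Fin n → Fin k) → Dec (DisjointWithin colour)
  disjoint-within? colour = all? λ u → all? λ v →
    (colour u ≟ colour v) →-dec ((u ≟ v) ⊎-dec ((r C u ≤? l C v) ⊎-dec (r C v ≤? l C u)))

  mult-≤-colours : ∀ {k} (colour : Fin n → Fin k) → DisjointWithin colour → ∀ x → mult C x ≤ k
  mult-≤-colours colour proper x = count-injection (contains? C x) (λ v _ → colour v) same-colour⇒equal
    where
    same-colour⇒equal : ∀ {u v} → u ∋ x → v ∋ x → colour u ≡ colour v → u ≡ v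
    same-colour⇒equal {u} {v} u∋x v∋x eq with proper u v eq
    ... | inj₁ u≡v        = u≡v
    ... | inj₂ (inj₁ u≺v) = ⊥-elim (≤⇒¬meets u≺v (x , u∋x , v∋x))
    ... | inj₂ (inj₂ v≺u) = ⊥-elim (≤⇒¬meets v≺u (x , v∋x , u∋x))

  clique-≤-width : ∀ {w ws k} → AllPairs _meets_ (w ∷ ws) → IsWid C k → distinct (w ∷ ws) ≤ k
  clique-≤-width clique (bounded , _) with x , all∋x ← helly clique =
    ℕ.≤-trans (distinct-≤-count (contains? C x) all∋x) (bounded x)

  covers-left : Fin n → Fin n → ℕ
  covers-left u v = 𝟙 (contains? C (lQ C v) u)

  private
    icost-∑ : icostRep C ≡ ∑[ v < n ] ∑[ u < n ] covers-left u v
    icost-∑ = trans (sum-allFin (λ v → mult C (lQ C v))) (sum-cong-≗ λ v → count-∑ (contains? C (lQ C v)))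

  -- An edge uv with l u < l v is counted in icost at the left endpoint of v.
  edge-covers-a-left-endpoint : (H : Graph n) → InR H C →
                                ∀ u v → 𝟙 (adj H u v Bool.≟ true) ≤ covers-left u v + covers-left v u
  edge-covers-a-left-endpoint H inR u v with adj H u v Bool.≟ true
  ... | no _ = z≤n
  ... | yes uv with ℕ.<-cmp (l C u) (l C v)
  ... | tri< lu<lv _ _ =
    ℕ.≤-trans (𝟙-yes (contains? C (lQ C v) u) (ℕ→ℚ-mono-< lu<lv , meets⇒left<right (meets-sym (inR u v uv)))) (ℕ.m≤m+n _ _)
  ... | tri> _ _ lv<lu =
    ℕ.≤-trans (𝟙-yes (contains? C (lQ C u) v) (ℕ→ℚ-mono-< lv<lu , meets⇒left<right (inR u v uv))) (ℕ.m≤n+m _ _)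
  ... | tri≈ _ lu≡lv _ with refl ← l-injective lu≡lv with () ← trans (sym uv) (irrefl H u)

  arcs-≤-twice-icost : (H : Graph n) → InR H C → arcs (adj H) ≤ icostRep C + icostRep C
  arcs-≤-twice-icost H inR = begin
    arcs (adj H)                                      ≤⟨ ∑-mono-≤ (λ u → ∑-mono-≤ (edge-covers-a-left-endpoint H inR u)) ⟩
    ∑[ u < n ] ∑[ v < n ] (κ u v + κ v u)             ≡⟨ sum-cong-≗ (λ u → ∑-distrib-+ (κ u) (λ v → κ v u)) ⟩
    ∑[ u < n ] (∑[ v < n ] κ u v + ∑[ v < n ] κ v u)  ≡⟨ ∑-distrib-+ (λ u → ∑[ v < n ] κ u v) (λ u → ∑[ v < n ] κ v u) ⟩
    ∑[ u < n ] ∑[ v < n ] κ u v + icostRep′           ≡⟨ cong (_+ icostRep′) (∑-comm κ) ⟩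
    icostRep′ + icostRep′                             ≡⟨ cong₂ _+_ (sym icost-∑) (sym icost-∑) ⟩
    icostRep C + icostRep C                           ∎
    where
    open ℕ.≤-Reasoning
    κ : Fin n → Fin n → ℕ
    κ = covers-left
    icostRep′ : ℕ
    icostRep′ = ∑[ v < n ] ∑[ u < n ] κ u v

module _ {n : ℕ} where

  open import Data.List.Membership.DecPropositional (≡-dec (_≟_ {n}) (_≟_ {n})) using (_∈?_)

  listed : List (Fin n × Fin n) → Adjacency n
  listed es u v = does ((u , v) ∈? es) ∨ does ((v , u) ∈? es)

  graph : (es : List (Fin n × Fin n)) → {True (all? λ v → listed es v v Bool.≟ false)} → Graph n
  graph es {loopless} = record
    { adj    = listed es
    ; sym    = λ u v → ∨-comm (does ((u , v) ∈? es)) (does ((v , u) ∈? es))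
    ; irrefl = toWitness loopless
    }

  listed-edge : ∀ {es a b} → (a , b) ∈ es → listed es a b ≡ true
  listed-edge {es} {a} {b} ab∈es with (a , b) ∈? es
  ... | yes _    = refl
  ... | no  ab∉es with () ← ab∉es ab∈es

  listed-least : ∀ {es} (H : Graph n) → (∀ {a b} → (a , b) ∈ es → Edge H a b) →
                 ∀ u v → listed es u v ≡ true → Edge H u v
  listed-least {es} H es⊆H u v uv with (u , v) ∈? es | (v , u) ∈? es
  ... | yes uv∈es | _         = es⊆H uv∈es
  ... | no  _     | yes vu∈es = trans (Graph.sym H u v) (es⊆H vu∈es)

module _ {n : ℕ} (l r : Fin n → ℕ) where

  private
    l<r? : Dec (∀ v → l v < r v)
    l<r? = all? λ v → l v <? r v

    l-range? : Dec (∀ v → 1 ≤ l v × l v ≤ n)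
    l-range? = all? λ v → (1 ≤? l v) ×-dec (l v ≤? n)

    l-onto? : Dec (∀ (k : Fin n) → ∃ λ v → l v ≡ suc (toℕ k))
    l-onto? = all? λ k → any? λ v → l v ℕ.≟ suc (toℕ k)

  canonical : {True l<r?} → {True l-range?} → {True l-onto?} → Canonical n
  canonical {l<r} {range} {onto} = record
    { l = l ; r = r ; l<r = toWitness l<r ; l-range = toWitness range ; l-onto = hits }
    where
    hits : ∀ k → 1 ≤ k → k ≤ n → ∃ λ v → l v ≡ k
    hits (suc k) _ k<n with v , eq ← toWitness onto (fromℕ< k<n) = v , trans eq (cong suc (toℕ-fromℕ< k<n))

module _ {n : ℕ} (G : Graph n) (C : Canonical n) where

  Overlapping : Set
  Overlapping = ∀ u v → Edge G u v → l C u < r C v × l C v < r C u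

  overlapping? : Dec Overlapping
  overlapping? = all? λ u → all? λ v → (adj G u v Bool.≟ true) →-dec ((l C u <? r C v) ×-dec (l C v <? r C u))

  overlapping⇒inR : Overlapping → InR G C
  overlapping⇒inR overlapping u v uv with lu<rv , lv<ru ← overlapping u v uv = overlap⇒meetsℕ C lu<rv lv<ru

-- The counterexample

edgesG : List (Fin 8 × Fin 8)
edgesG = (# 0 , # 2) ∷ (# 0 , # 3) ∷ (# 0 , # 5) ∷ (# 1 , # 2) ∷ (# 2 , # 3) ∷ (# 2 , # 4)
       ∷ (# 2 , # 6) ∷ (# 3 , # 4) ∷ (# 3 , # 5) ∷ (# 3 , # 7) ∷ (# 4 , # 7) ∷ []

G : Graph 8
G = graph edgesG

narrow : Canonical 8
narrow = canonical (lookup (1 ∷ 5 ∷ 4 ∷ 2 ∷ 7 ∷ 3 ∷ 6 ∷ 8 ∷ [])) (lookup (5 ∷ 6 ∷ 8 ∷ 9 ∷ 9 ∷ 4 ∷ 7 ∷ 9 ∷ []))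

narrow-width : IsWid narrow 3
narrow-width = mult-≤-colours narrow chain (from-yes (disjoint-within? narrow chain)) , ℤ.+ 9 / 2 , refl
  where
  chain : Fin 8 → Fin 3
  chain = lookup (# 0 ∷ # 0 ∷ # 1 ∷ # 2 ∷ # 0 ∷ # 1 ∷ # 0 ∷ # 1 ∷ [])

narrow-inR : InR G narrow
narrow-inR = overlapping⇒inR G narrow (from-yes (overlapping? G narrow))

cheap : Canonical 8
cheap = canonical (lookup (1 ∷ 7 ∷ 4 ∷ 2 ∷ 5 ∷ 3 ∷ 8 ∷ 6 ∷ [])) (lookup (5 ∷ 8 ∷ 9 ∷ 7 ∷ 7 ∷ 4 ∷ 9 ∷ 7 ∷ []))

cheap-icost : icostRep cheap ≡ 12
cheap-icost = refl

cheap-inR : InR G cheap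
cheap-inR = overlapping⇒inR G cheap (from-yes (overlapping? G cheap))

edge⇒≢ : ∀ {n} (H : Graph n) {u v} → Edge H u v → u ≢ v
edge⇒≢ H {u} uv refl with () ← trans (sym uv) (irrefl H u)

clique-bound : ∀ {w} (G′ : Graph 8) → IsIwid G w → IsIwid G′ w →
               ∀ {v vs} → AllPairs (Edge G′) (v ∷ vs) → distinct (v ∷ vs) ≤ 3
clique-bound G′ (_ , narrowest) ((C , C-inR , C-width) , _) clique =
  ℕ.≤-trans (clique-≤-width C (AllPairs.map (C-inR _ _) clique) C-width) (narrowest narrow narrow-inR 3 narrow-width)

arcs-bound : ∀ {c} (G′ : Graph 8) → IsIcost G c → IsIcost G′ c → arcs (adj G′) ≤ 24
arcs-bound G′ (_ , cheapest) ((C , C-inR , refl) , _) =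
  ℕ.≤-trans (arcs-≤-twice-icost C G′ C-inR) (ℕ.+-mono-≤ c≤12 c≤12)
  where
  c≤12 : icostRep C ≤ 12
  c≤12 = subst (icostRep C ≤_) cheap-icost (cheapest cheap cheap-inR)

module SmallIntervalSupergraph
  (G′ : Graph 8) (G⊆G′ : G ⊆G G′) (I : IntervalFamily 8) (I-rep : Represents I G′)
  (few-arcs : arcs (adj G′) ≤ 24)
  (small-cliques : ∀ {v vs} → AllPairs (Edge G′) (v ∷ vs) → distinct (v ∷ vs) ≤ 3)
  where

  open OpenIntervals I

  edge⇒meets : ∀ {u v} → Edge G′ u v → u meets v
  edge⇒meets uv = Equivalence.to (I-rep _ _ (edge⇒≢ G′ uv)) uv

  absent⇒disjoint : ∀ {u v} → ¬ Edge G′ u v → {False (u ≟ v)} → ¬ u meets v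
  absent⇒disjoint ¬uv {u≢v} = ¬uv ∘ Equivalence.from (I-rep _ _ (toWitnessFalse u≢v))

  -- Implicit arguments of type T … or False … are discharged by evaluation at concrete vertices.
  old : ∀ u v → {T (adj G u v)} → Edge G′ u v
  old u v {uv} = G⊆G′ u v (Equivalence.to T-≡ uv)

  ⌢ : ∀ u v → {T (adj G u v)} → u meets v
  ⌢ u v {uv} = edge⇒meets (old u v {uv})

  -- G has 22 arcs, so for two different non-edges ab and cd of G the check evaluates to 24 < 26.
  second-new-edge-absent : ∀ {a b} → Edge G′ a b → ∀ c d →
                           {T (24 <ᵇ arcs (listed ((a , b) ∷ (c , d) ∷ edgesG)))} → ¬ Edge G′ c d
  second-new-edge-absent {a} {b} ab c d {many} cd =
    ℕ.<⇒≱ (ℕ.<ᵇ⇒< 24 _ many) (ℕ.≤-trans (arcs-mono (listed-least G′ in-G′)) few-arcs)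
    where
    in-G′ : ∀ {x y} → (x , y) ∈ (a , b) ∷ (c , d) ∷ edgesG → Edge G′ x y
    in-G′ (here refl)         = ab
    in-G′ (there (here refl)) = cd
    in-G′ (there (there xy))  = G⊆G′ _ _ (listed-edge xy)

  ≁ : ∀ {a b} → Edge G′ a b → ∀ c d →
      {T (24 <ᵇ arcs (listed ((a , b) ∷ (c , d) ∷ edgesG)))} → {False (c ≟ d)} → ¬ c meets d
  ≁ ab c d {many} {c≢d} = absent⇒disjoint (second-new-edge-absent ab c d {many}) {c≢d}

  no-15 : ¬ Edge G′ (# 1) (# 5)
  no-15 e = walks-around-gap-meet (≁ e (# 0) (# 1))
    (⌢ (# 0) (# 2) ∷ [ ⌢ (# 2) (# 1) ])
    (⌢ (# 0) (# 5) ∷ [ meets-sym (edge⇒meets e) ])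
    ((≁ e (# 2) (# 5) ∷ []) ∷ [])

  no-17 : ¬ Edge G′ (# 1) (# 7)
  no-17 e = walks-around-gap-meet (≁ e (# 1) (# 3))
    (⌢ (# 1) (# 2) ∷ [ ⌢ (# 2) (# 3) ])
    (edge⇒meets e ∷ [ ⌢ (# 7) (# 3) ])
    ((≁ e (# 2) (# 7) ∷ []) ∷ [])

  no-07 : ¬ Edge G′ (# 0) (# 7)
  no-07 e = walks-around-gap-meet (≁ e (# 0) (# 4))
    (⌢ (# 0) (# 2) ∷ [ ⌢ (# 2) (# 4) ])
    (edge⇒meets e ∷ [ ⌢ (# 7) (# 4) ])
    ((≁ e (# 2) (# 7) ∷ []) ∷ [])

  no-45 : ¬ Edge G′ (# 4) (# 5)
  no-45 e = walks-around-gap-meet (≁ e (# 0) (# 4))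
    (⌢ (# 0) (# 2) ∷ [ ⌢ (# 2) (# 4) ])
    (⌢ (# 0) (# 5) ∷ [ meets-sym (edge⇒meets e) ])
    ((≁ e (# 2) (# 5) ∷ []) ∷ [])

  no-57 : ¬ Edge G′ (# 5) (# 7)
  no-57 e = walks-around-gap-meet (≁ e (# 0) (# 4))
    (⌢ (# 0) (# 2) ∷ [ ⌢ (# 2) (# 4) ])
    (⌢ (# 0) (# 5) ∷ edge⇒meets e ∷ [ ⌢ (# 7) (# 4) ])
    ((≁ e (# 2) (# 5) ∷ ≁ e (# 2) (# 7) ∷ []) ∷ [])

  no-13 : ¬ Edge G′ (# 1) (# 3)
  no-13 e = no-asteroidal-triple (≁ e (# 5) (# 6)) (≁ e (# 6) (# 7)) (≁ e (# 7) (# 5))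
    (⌢ (# 5) (# 0) ∷ ⌢ (# 0) (# 2) ∷ [ ⌢ (# 2) (# 6) ])
    (⌢ (# 6) (# 2) ∷ ⌢ (# 2) (# 4) ∷ [ ⌢ (# 4) (# 7) ])
    (⌢ (# 7) (# 3) ∷ [ ⌢ (# 3) (# 5) ])
    (≁ e (# 0) (# 7) ∷ ≁ e (# 2) (# 7) ∷ [])
    (≁ e (# 2) (# 5) ∷ ≁ e (# 4) (# 5) ∷ [])
    (≁ e (# 3) (# 6) ∷ [])

  no-25 : ¬ Edge G′ (# 2) (# 5)
  no-25 e = ℕ.1+n≰n (small-cliques {# 0} {# 2 ∷ # 3 ∷ # 5 ∷ []}
    ((old (# 0) (# 2) ∷ old (# 0) (# 3) ∷ old (# 0) (# 5) ∷ [])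
    ∷ (old (# 2) (# 3) ∷ e ∷ []) ∷ (old (# 3) (# 5) ∷ []) ∷ [] ∷ []))

  no-27 : ¬ Edge G′ (# 2) (# 7)
  no-27 e = ℕ.1+n≰n (small-cliques {# 2} {# 3 ∷ # 4 ∷ # 7 ∷ []}
    ((old (# 2) (# 3) ∷ old (# 2) (# 4) ∷ e ∷ [])
    ∷ (old (# 3) (# 4) ∷ old (# 3) (# 7) ∷ []) ∷ (old (# 4) (# 7) ∷ []) ∷ [] ∷ []))

  G-needs-a-new-edge : ¬ Edge G′ (# 1) (# 3) → ¬ Edge G′ (# 1) (# 5) → ¬ Edge G′ (# 1) (# 7) →
                       ¬ Edge G′ (# 2) (# 7) → ¬ Edge G′ (# 0) (# 7) → ¬ Edge G′ (# 5) (# 7) →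
                       ¬ Edge G′ (# 2) (# 5) → ¬ Edge G′ (# 4) (# 5) → ⊥
  G-needs-a-new-edge ¬13 ¬15 ¬17 ¬27 ¬07 ¬57 ¬25 ¬45 =
    no-asteroidal-triple (absent⇒disjoint ¬15) (absent⇒disjoint ¬57) (absent⇒disjoint ¬17 ∘ meets-sym)
      (⌢ (# 1) (# 2) ∷ ⌢ (# 2) (# 0) ∷ [ ⌢ (# 0) (# 5) ])
      (⌢ (# 5) (# 3) ∷ [ ⌢ (# 3) (# 7) ])
      (⌢ (# 7) (# 4) ∷ ⌢ (# 4) (# 2) ∷ [ ⌢ (# 2) (# 1) ])
      (absent⇒disjoint ¬27 ∷ absent⇒disjoint ¬07 ∷ [])
      ((absent⇒disjoint ¬13 ∘ meets-sym) ∷ [])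
      (absent⇒disjoint ¬45 ∷ absent⇒disjoint ¬25 ∷ [])

  impossible : ⊥
  impossible = G-needs-a-new-edge no-13 no-15 no-17 no-27 no-07 no-57 no-25 no-45

theorem6 : Σ ℕ λ n → Σ (Graph n) λ G →
    ∀ (G' : Graph n) → G ⊆G G' → IsIntervalGraph G' →
      ¬ (∃ λ w → ∃ λ c →
           IsIwid G w × IsIwid G' w × IsIcost G c × IsIcost G' c)
theorem6 = 8 , G , λ G′ G⊆G′ (I , I-rep) (_ , _ , iwid-G , iwid-G′ , icost-G , icost-G′) →
  SmallIntervalSupergraph.impossible G′ G⊆G′ I I-rep (arcs-bound G′ icost-G icost-G′) (clique-bound G′ iwid-G iwid-G′)
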